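{- For all integers $n\geq k>d\geq 1$, \[T(n,k,d)=t(n-k+d,d)+T(n,k-d+1,1),\] and for all integers $n\geq k\geq 1$ and $d\geq 1$ with $k\leq d$, \[T(n,k,d)=t(n,k).\]
   Context: A box in $\mathbb{R}^d$ is an axis-parallel box, i.e. a Cartesian product $[a_1,b_1]\times\dots\times[a_d,b_d]$ of compact intervals (degenerate intervals $a_i=b_i$ allowed). A family of $n$ boxes is a list of $n$ boxes (repetitions allowed); an intersecting pair is an unordered pair of distinct members of the list with nonempty intersection. For integers $n\geq k\geq 1$ and $d\geq 1$, $T(n,k,d)$ denotes the maximum number of intersecting pairs in a family of $n$ boxes in $\mathbb{R}^d$ with the property that no $k+1$ members of the family have a point in common. For integers $n\geq m\geq 1$, $t(n,m)$ denotes the number of edges of the Turán graph $\mathcal{T}(n,m)$, the complete $m$-partite graph on $n$ vertices whose $m$ vertex classes have sizes differing by at most one; $t(n,1)=0$.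
   Formalization: The boxes lie in ℚ^d instead of ℝ^d, with rational endpoints and common points, so $T(n,k,d)$ is the maximum over families of such rational boxes only. -}

module Defs where

open import Data.Nat as ℕ using (ℕ; zero; suc; _+_; _%_)
open import Data.Nat.Properties using (_≟_)
open import Data.Fin using (Fin; toℕ) renaming (_<_ to _<ᶠ_)
open import Data.Fin.Subset using (Subset; _∈_; ∣_∣)
open import Data.Rational using (ℚ) renaming (_≤_ to _≤ℚ_)
open import Data.Product using (Σ; _×_; _,_; ∃)
open import Data.List using (List; length)
open import Data.List.Relation.Unary.All using (All)
open import Data.List.Relation.Unary.Unique.Propositional using (Unique)
import Data.List.Membership.Propositional as LM
open import Relation.Binary.PropositionalEquality using (_≡_)
open import Relation.Nullary using (¬_; yes; no)

record Box (d : ℕ) : Set where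
  field
    lo    : Fin d → ℚ
    hi    : Fin d → ℚ
    lo≤hi : ∀ i → lo i ≤ℚ hi i
open Box public

Point : ℕ → Set
Point d = Fin d → ℚ

_∈Box_ : ∀ {d} → Point d → Box d → Set
p ∈Box B = ∀ i → (lo B i ≤ℚ p i) × (p i ≤ℚ hi B i)

Family : ℕ → ℕ → Set
Family n d = Fin n → Box d

Intersect : ∀ {d} → Box d → Box d → Set
Intersect A B = ∃ λ p → (p ∈Box A) × (p ∈Box B)

NoKPlus1Common : ∀ {n d} → ℕ → Family n d → Set
NoKPlus1Common {n} {d} k F =
  (S : Subset n) → ∣ S ∣ ≡ suc k → ¬ (∃ λ (p : Point d) → ∀ i → i ∈ S → p ∈Box F i)

NumIntersectingPairs : ∀ {n d} → Family n d → ℕ → Set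
NumIntersectingPairs {n} F c =
  Σ (List (Fin n × Fin n)) λ L →
    Unique L
    × All (λ { (i , j) → (i <ᶠ j) × Intersect (F i) (F j) }) L
    × (∀ i j → i <ᶠ j → Intersect (F i) (F j) → (i , j) LM.∈ L)
    × length L ≡ c

IsT : ℕ → ℕ → ℕ → ℕ → Set
IsT n k d v =
  (∃ λ (F : Family n d) → NoKPlus1Common k F × NumIntersectingPairs F v)
  × (∀ (F : Family n d) c → NoKPlus1Common k F → NumIntersectingPairs F c → c ℕ.≤ v)

-- Turán graph T(n,m): vertices 0..n-1, vertex v in class (v mod m) (classes
-- differ in size by at most one); t(n,m) = number of pairs i < j in different classes.
-- (m = 0 is unused; t(n,0) := 0.)
private
  countBelow : ℕ → ℕ → ℕ → ℕ
  countBelow m zero j = 0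
  countBelow zero (suc i) j = 0
  countBelow (suc m) (suc i) j with (i % suc m) ≟ (j % suc m)
  ... | yes _ = countBelow (suc m) i j
  ... | no _  = suc (countBelow (suc m) i j)

  turanAux : ℕ → ℕ → ℕ
  turanAux m zero = 0
  turanAux m (suc j) = turanAux m j + countBelow m j j

turan : ℕ → ℕ → ℕ
turan n m = turanAux m n

{-# OPTIONS --safe #-}
module Submission where

-- Both upper bounds remove, one at a time, a vertex of the intersection graph with many
-- non-neighbours, using t(n+1,m) = t(n,m) + n - s where s = #{i < n : i ≡ n mod m} ≤ n/m.
-- For depth k ≤ d, Helly's theorem for boxes makes the graph K_{k+1}-free, and greedily growing a
-- clique finds a vertex with s non-neighbours, as in Turán's theorem.  For k > d, sweeping the d
-- coordinates, each time keeping the candidate box with the lowest upper end, finds a box disjoint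
-- from s others (now with N = n - k + d in place of n and m = d), since otherwise k + 1 boxes would
-- share a point; the k - d surplus boxes contribute at most the edges of k - d universal vertices,
-- which is T(n,k-d+1,1).  Equality holds for N slabs, slab i pinning coordinate i mod m to the value
-- i, together with k - d copies of a cube containing them all: two slabs meet iff their residues differ.

open import Defs

open import Algebra.Properties.CommutativeSemigroup as CommSemigroup using ()
open import Data.Empty using (⊥-elim)
open import Data.Fin.Base as Fin using (Fin; zero; suc; fromℕ<)
open import Data.Fin.Properties using (all?; fromℕ<-cong; fromℕ<-injective)
  renaming (_≟_ to _≟ᶠ_; suc-injective to suc-injectiveᶠ)
open import Data.Fin.Subset as Subset using (Subset; inside; outside; ∣_∣)
open import Data.Fin.Subset.Properties using (∣⊥∣≡0; ∉⊥)
open import Data.Integer.Base as ℤ using (+≤+)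
import Data.Integer.Properties as ℤ
open import Data.List.Base using (List; []; _∷_; _++_; length; map; filter; tabulate; downFrom; upTo; allFin)
open import Data.List.Properties
  using (length-tabulate; map-tabulate; length-++; length-map; length-filter; length-downFrom; length-upTo;
         filter-++; filter-all; filter-none; filter-accept; filter-reject)
open import Data.List.Membership.Propositional using (_∈_; _∉_)
open import Data.List.Membership.Propositional.Properties
  using (∈-∃++; ∈-filter⁺; ∈-filter⁻; ∈-map⁺; ∈-map⁻; ∈-++⁺ˡ; ∈-++⁺ʳ; ∈-++⁻; ∈-allFin; ∈-downFrom⁻; ∈-upTo⁺)
open import Data.List.Relation.Binary.Permutation.Propositional as ↭ using (_↭_; prep; swap; ↭-sym; ↭-trans)
open import Data.List.Relation.Binary.Permutation.Propositional.Properties using (↭-length; filter-↭; shift; ∈-resp-↭; ++⁺ˡ)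
open import Data.List.Relation.Unary.All as All using (All; []; _∷_)
open import Data.List.Relation.Unary.All.Properties using (map⁺)
open import Data.List.Relation.Unary.AllPairs using (AllPairs; []; _∷_)
open import Data.List.Relation.Unary.Any as Any using (here; there)
open import Data.List.Relation.Unary.Unique.Propositional using (Unique)
open import Data.List.Relation.Unary.Unique.Propositional.Properties using (downFrom⁺; allFin⁺)
  renaming (filter⁺ to unique-filter⁺; map⁺ to unique-map⁺; ++⁺ to unique-++⁺)
open import Data.Nat.Base using (ℕ; zero; suc; _+_; _*_; _∸_; _≤_; _<_; z≤n; s≤s; _%_; _/_)
open import Data.Nat.Coprimality as Coprime using (1-coprimeTo)
open import Data.Nat.DivMod using (m≡m%n+[m/n]*n; m/n*n≤m; /-monoˡ-≤; n%1≡0; m%n<n; m%n%n≡m%n)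
open import Data.Nat.Properties
open import Data.Nat.Solver using (module +-*-Solver)
open import Data.Product.Base as Product using (Σ-syntax; ∃; _×_; _,_; proj₁; proj₂)
open import Data.Rational.Base as ℚ using (ℚ; 0ℚ)
import Data.Rational.Properties as ℚ
open import Data.Sum.Base using (inj₁; inj₂)
open import Data.Vec.Base using ([]; _∷_; here; there)
open import Data.Vec.Functional using (updateAt)
open import Data.Vec.Functional.Properties using (updateAt-updates; updateAt-minimal)
open import Function.Base using (_∘_; id)
open import Level using (0ℓ)
open import Relation.Binary.Bundles using (DecTotalOrder)
open import Relation.Binary.PropositionalEquality
  using (_≡_; _≢_; refl; sym; trans; cong; cong₂; subst; subst₂; module ≡-Reasoning)
open import Relation.Nullary.Decidable using (Dec; yes; no; ¬?; _×-dec_; _→-dec_; map′)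
open import Relation.Nullary.Negation using (¬_; contradiction)
open import Relation.Unary using (Pred; Decidable; ∁)
open import Relation.Unary.Properties using (∁?; _∩?_)

open import Data.List.Extrema (DecTotalOrder.totalOrder ℚ.≤-decTotalOrder)
  using (argmin; f[argmin]≤f[⊤]; f[argmin]≤f[xs]; argmin-all; max; ⊥≤max; xs≤max; max≤v⁺)

open CommSemigroup +-commutativeSemigroup using (x∙yz≈y∙xz; x∙yz≈y∙zx; xy∙z≈xz∙y; xy∙z≈y∙xz)
open +-*-Solver using (solve; _:+_; _:=_)

count : {A : Set} {P : Pred A 0ℓ} → Decidable P → List A → ℕ
count P? xs = length (filter P? xs)

module _ {A : Set} {P : Pred A 0ℓ} (P? : Decidable P) where

  count-++ : ∀ xs ys → count P? (xs ++ ys) ≡ count P? xs + count P? ys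
  count-++ xs ys = trans (cong length (filter-++ P? xs ys)) (length-++ (filter P? xs))

  count-↭ : ∀ {xs ys} → xs ↭ ys → count P? xs ≡ count P? ys
  count-↭ = ↭-length ∘ filter-↭ P?

  count≤length : ∀ xs → count P? xs ≤ length xs
  count≤length = length-filter P?

  count-all : ∀ {xs} → All P xs → count P? xs ≡ length xs
  count-all = cong length ∘ filter-all P?

  count-accept : ∀ x xs → P x → count P? (x ∷ xs) ≡ suc (count P? xs)
  count-accept _ xs = cong length ∘ filter-accept P?

  count-none : ∀ {xs} → All (∁ P) xs → count P? xs ≡ 0
  count-none = cong length ∘ filter-none P?

  count-reject : ∀ x xs → ¬ P x → count P? (x ∷ xs) ≡ count P? xs
  count-reject _ xs = cong length ∘ filter-reject P?

  count-∷-≤ : ∀ x xs → count P? (x ∷ xs) ≤ suc (count P? xs)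
  count-∷-≤ x xs with P? x
  ... | yes _ = ≤-refl
  ... | no _  = n≤1+n _

  count≤count-∷ : ∀ x xs → count P? xs ≤ count P? (x ∷ xs)
  count≤count-∷ x xs with P? x
  ... | yes _ = n≤1+n _
  ... | no _  = ≤-refl

  count+count-∁ : ∀ xs → count P? xs + count (∁? P?) xs ≡ length xs
  count+count-∁ []       = refl
  count+count-∁ (x ∷ xs) with P? x
  ... | yes _ = cong suc (count+count-∁ xs)
  ... | no _  = trans (+-suc _ _) (cong suc (count+count-∁ xs))

  ∈-of-0<count : ∀ {xs} → 0 < count P? xs → ∃ λ x → x ∈ xs × P x
  ∈-of-0<count {xs} 0<c with filter P? xs in eq
  ∈-of-0<count {xs} () | []
  ... | y ∷ _ = y , ∈-filter⁻ P? (subst (y ∈_) (sym eq) (here refl))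

  module _ {B : Set} (f : B → A) where

    count-map : ∀ xs → count P? (map f xs) ≡ count (P? ∘ f) xs
    count-map []       = refl
    count-map (x ∷ xs) with P? (f x)
    ... | yes _ = cong suc (count-map xs)
    ... | no _  = count-map xs

  module _ {Q : Pred A 0ℓ} (Q? : Decidable Q) where

    count-mono : ∀ {xs} → All (λ x → P x → Q x) xs → count P? xs ≤ count Q? xs
    count-mono {[]}     []       = z≤n
    count-mono {x ∷ xs} (h ∷ hs) with P? x | Q? x
    ... | yes p | yes _  = s≤s (count-mono hs)
    ... | yes p | no ¬q  = contradiction (h p) ¬q
    ... | no _  | yes _  = m≤n⇒m≤1+n (count-mono hs)
    ... | no _  | no _   = count-mono hs

    count-split : ∀ xs → count P? xs ≡ count (P? ∩? Q?) xs + count (P? ∩? ∁? Q?) xs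
    count-split []       = refl
    count-split (x ∷ xs) with P? x | Q? x
    ... | yes _ | yes _ = cong suc (count-split xs)
    ... | yes _ | no _  = trans (cong suc (count-split xs)) (sym (+-suc _ _))
    ... | no _  | _     = count-split xs

module _ {A : Set} where

  tabulate-downFrom : ∀ (f : ℕ → A) n → tabulate {n = n} (λ i → f (n ∸ suc (Fin.toℕ i))) ≡ map f (downFrom n)
  tabulate-downFrom f zero    = refl
  tabulate-downFrom f (suc n) = cong (f n ∷_) (tabulate-downFrom f n)

  ∈⇒∃↭ : ∀ {x : A} {xs} → x ∈ xs → ∃ λ ys → xs ↭ x ∷ ys
  ∈⇒∃↭ x∈xs with ys , zs , refl ← ∈-∃++ x∈xs = ys ++ zs , shift _ ys zs

  unique-⊆⇒length≤ : ∀ {xs ys : List A} → Unique xs → (∀ {x} → x ∈ xs → x ∈ ys) → length xs ≤ length ys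
  unique-⊆⇒length≤ {[]}     _          _  = z≤n
  unique-⊆⇒length≤ {x ∷ xs} (x∉ ∷ uniq) xs⊆ys with ys′ , ys↭ ← ∈⇒∃↭ (xs⊆ys (here refl)) =
    subst (suc (length xs) ≤_) (sym (↭-length ys↭)) (s≤s (unique-⊆⇒length≤ uniq xs⊆ys′))
    where
      xs⊆ys′ : ∀ {z} → z ∈ xs → z ∈ ys′
      xs⊆ys′ z∈xs with ∈-resp-↭ ys↭ (xs⊆ys (there z∈xs))
      ... | here z≡x  = contradiction (sym z≡x) (All.lookup x∉ z∈xs)
      ... | there z∈ = z∈

module _ {A : Set} (f : A → ℚ) {P : Pred A 0ℓ} (P? : Decidable P) where

  argmin-on : ∀ {xs} → 0 < count P? xs → ∃ λ x → x ∈ xs × P x × (∀ {y} → y ∈ xs → P y → f x ℚ.≤ f y)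
  argmin-on {xs} 0<c with filter P? xs in eq
  argmin-on {xs} () | []
  ... | y₀ ∷ ys = x , proj₁ x∈xs×Px , proj₂ x∈xs×Px , minimal
    where
      x : A
      x = argmin f y₀ ys
      x∈xs×Px : x ∈ xs × P x
      x∈xs×Px = ∈-filter⁻ P? (subst (x ∈_) (sym eq) (argmin-all f {P = _∈ y₀ ∷ ys} (here refl) (All.tabulate there)))
      minimal : ∀ {y} → y ∈ xs → P y → f x ℚ.≤ f y
      minimal y∈xs Py with subst (_ ∈_) eq (∈-filter⁺ P? y∈xs Py)
      ... | here refl  = f[argmin]≤f[⊤] {f = f} y₀ ys
      ... | there y∈ys = All.lookup (f[argmin]≤f[xs] {f = f} y₀ ys) y∈ys

module TuranNumbers (m : ℕ) where

  private
    M = suc m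

  SameClass : ℕ → ℕ → Set
  SameClass j i = i % M ≡ j % M

  sameClass? : ∀ j → Decidable (SameClass j)
  sameClass? j i = i % M ≟ j % M

  sameClassBelow differentClassBelow : ℕ → ℕ
  sameClassBelow      n = count (sameClass? n) (downFrom n)
  differentClassBelow n = count (∁? (sameClass? n)) (downFrom n)

  -- countBelow is private in Defs: the helper function generated for its with-clause is
  -- captured as the metavariable countBelow-step, solved by unification against turan.
  private
    mutual
      countBelow-step : (i j : ℕ) → Dec (i % M ≡ j % M) → ℕ
      countBelow-step = _

      turan-unfold : ∀ j → turan (suc (suc j)) M ≡ turan (suc j) M + countBelow-step j (suc j) (j % M ≟ suc j % M)
      turan-unfold j with suc j | j % M ≟ suc j % M
      ... | _ | _ = refl

    countBelow-step≗count : ∀ i j (i≟j : Dec (i % M ≡ j % M)) →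
                            countBelow-step i j i≟j ≡ count (∁? (sameClass? j)) (downFrom (suc i))
    countBelow-step≗count zero    j (yes eq) = sym (count-reject (∁? (sameClass? j)) 0 [] λ ¬eq → ¬eq eq)
    countBelow-step≗count zero    j (no ¬eq) = sym (count-accept (∁? (sameClass? j)) 0 [] ¬eq)
    countBelow-step≗count (suc i) j (yes eq) =
      trans (countBelow-step≗count i j (i % M ≟ j % M))
            (sym (count-reject (∁? (sameClass? j)) (suc i) (downFrom (suc i)) λ ¬eq → ¬eq eq))
    countBelow-step≗count (suc i) j (no ¬eq) =
      trans (cong suc (countBelow-step≗count i j (i % M ≟ j % M)))
            (sym (count-accept (∁? (sameClass? j)) (suc i) (downFrom (suc i)) ¬eq))

  turan-suc : ∀ n → turan (suc n) M ≡ turan n M + differentClassBelow n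
  turan-suc zero    = refl
  turan-suc (suc n) = trans (turan-unfold n) (cong (turan (suc n) M +_) (countBelow-step≗count n (suc n) (n % M ≟ suc n % M)))

  turan-suc-sameClass : ∀ n → turan n M + n ≡ turan (suc n) M + sameClassBelow n
  turan-suc-sameClass n = begin
    turan n M + n                                                ≡⟨ cong (turan n M +_) partition ⟩
    turan n M + (differentClassBelow n + sameClassBelow n)       ≡⟨ sym (+-assoc (turan n M) _ _) ⟩
    turan n M + differentClassBelow n + sameClassBelow n         ≡⟨ cong (_+ sameClassBelow n) (sym (turan-suc n)) ⟩
    turan (suc n) M + sameClassBelow n                           ∎
    where
      open ≡-Reasoning
      partition : n ≡ differentClassBelow n + sameClassBelow n
      partition = begin
        n                                           ≡⟨ sym (length-downFrom n) ⟩
        length (downFrom n)                         ≡⟨ sym (count+count-∁ (sameClass? n) (downFrom n)) ⟩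
        sameClassBelow n + differentClassBelow n    ≡⟨ +-comm (sameClassBelow n) _ ⟩
        differentClassBelow n + sameClassBelow n    ∎

  -- the classmates of n below n are n % M + q * M for distinct q < n / M
  sameClassBelow-bound : ∀ n → M * sameClassBelow n ≤ n
  sameClassBelow-bound n = begin
    M * sameClassBelow n  ≤⟨ *-monoʳ-≤ M (unique-⊆⇒length≤ classmates-unique classmates⊆) ⟩
    M * length multiples  ≡⟨ cong (M *_) (trans (length-map _ (upTo (n / M))) (length-upTo (n / M))) ⟩
    M * (n / M)           ≡⟨ *-comm M (n / M) ⟩
    (n / M) * M           ≤⟨ m/n*n≤m n M ⟩
    n                     ∎
    where
      open ≤-Reasoning
      classmates multiples : List ℕ
      classmates = filter (sameClass? n) (downFrom n)
      multiples  = map (λ q → n % M + q * M) (upTo (n / M))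

      classmates-unique : Unique classmates
      classmates-unique = unique-filter⁺ (sameClass? n) {downFrom n} (downFrom⁺ n)

      classmates⊆ : ∀ {i} → i ∈ classmates → i ∈ multiples
      classmates⊆ {i} i∈ = subst (_∈ multiples) (sym i≡) (∈-map⁺ _ (∈-upTo⁺ i/M<n/M))
        where
          i<n : i < n
          i<n = ∈-downFrom⁻ (proj₁ (∈-filter⁻ (sameClass? n) {xs = downFrom n} i∈))
          same : SameClass n i
          same = proj₂ (∈-filter⁻ (sameClass? n) {xs = downFrom n} i∈)
          i≡ : i ≡ n % M + (i / M) * M
          i≡ = trans (m≡m%n+[m/n]*n i M) (cong (_+ (i / M) * M) same)
          i/M<n/M : i / M < n / M
          i/M<n/M = ≤∧≢⇒< (/-monoˡ-≤ M (<⇒≤ i<n)) λ eq → <⇒≢ i<n (begin-equality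
            i                       ≡⟨ i≡ ⟩
            n % M + (i / M) * M     ≡⟨ cong (λ q → n % M + q * M) eq ⟩
            n % M + (n / M) * M     ≡⟨ sym (m≡m%n+[m/n]*n n M) ⟩
            n                       ∎)

turan-1 : ∀ n → turan n 1 ≡ 0
turan-1 zero    = refl
turan-1 (suc n) = trans (turan-suc n) (cong₂ _+_ (turan-1 n) (count-none _ (All.universal noOtherClass (downFrom n))))
  where
    open TuranNumbers 0
    noOtherClass : ∀ i → ¬ ¬ SameClass n i
    noOtherClass i ¬same = ¬same (trans (n%1≡0 i) (sym (n%1≡0 n)))

-- the edges gained by adding u universal vertices to N others
apexEdges : ℕ → ℕ → ℕ
apexEdges zero    N = 0
apexEdges (suc u) N = (u + N) + apexEdges u N

apexEdges-suc : ∀ u N → apexEdges u (suc N) ≡ apexEdges u N + u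
apexEdges-suc zero    N = refl
apexEdges-suc (suc u) N = begin
  (u + suc N) + apexEdges u (suc N)     ≡⟨ cong₂ _+_ (+-suc u N) (apexEdges-suc u N) ⟩
  suc (u + N) + (apexEdges u N + u)     ≡⟨ cong suc (sym (+-assoc (u + N) _ u)) ⟩
  suc ((u + N) + apexEdges u N + u)     ≡⟨ sym (+-suc _ u) ⟩
  (u + N) + apexEdges u N + suc u       ∎
  where open ≡-Reasoning

invariant-step : ∀ a r b {c c′} → a + suc r * b < c → c ≤ c′ + b → a + r * b < c′
invariant-step a r b {c} {c′} a+[1+r]b<c c≤c′+b = +-cancelʳ-< b (a + r * b) c′ (begin-strict
  a + r * b + b     ≡⟨ +-assoc a (r * b) b ⟩
  a + (r * b + b)   ≡⟨ cong (a +_) (+-comm (r * b) b) ⟩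
  a + suc r * b     <⟨ a+[1+r]b<c ⟩
  c                 ≤⟨ c≤c′+b ⟩
  c′ + b            ∎)
  where open ≤-Reasoning

module Graph {A : Set} {R : A → A → Set} (R? : ∀ x → Decidable (R x)) (R-sym : ∀ {x y} → R x y → R y x) where

  edges : List A → ℕ
  edges []       = 0
  edges (x ∷ xs) = count (R? x) xs + edges xs

  private
    rearrange : ∀ {a b c a′ b′ c′} → a ≡ a′ → b ≡ b′ → c ≡ c′ → a + (b + c) ≡ b′ + (a′ + c′)
    rearrange {a} {b} {c} refl refl refl = x∙yz≈y∙xz a b c

    edges-swap : ∀ x y {xs ys} → xs ↭ ys → edges xs ≡ edges ys → edges (x ∷ y ∷ xs) ≡ edges (y ∷ x ∷ ys)
    edges-swap x y p eq with R? x y | R? y x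
    ... | yes _  | yes _  = cong suc (rearrange (count-↭ (R? x) p) (count-↭ (R? y) p) eq)
    ... | no _   | no _   = rearrange (count-↭ (R? x) p) (count-↭ (R? y) p) eq
    ... | yes xy | no ¬yx = contradiction (R-sym xy) ¬yx
    ... | no ¬xy | yes yx = contradiction (R-sym yx) ¬xy

  edges-↭ : ∀ {xs ys} → xs ↭ ys → edges xs ≡ edges ys
  edges-↭ ↭.refl        = refl
  edges-↭ (prep x p)    = cong₂ _+_ (count-↭ (R? x) p) (edges-↭ p)
  edges-↭ (swap x y p)  = edges-swap x y p (edges-↭ p)
  edges-↭ (↭.trans p q) = trans (edges-↭ p) (edges-↭ q)

  edges-removal : ∀ {x xs ys} → xs ↭ x ∷ ys → edges xs + count (∁? (R? x)) ys ≡ length ys + edges ys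
  edges-removal {x} {xs} {ys} xs↭ = begin
    edges xs + count (∁? (R? x)) ys                          ≡⟨ cong (_+ count (∁? (R? x)) ys) (edges-↭ xs↭) ⟩
    count (R? x) ys + edges ys + count (∁? (R? x)) ys        ≡⟨ xy∙z≈xz∙y (count (R? x) ys) _ _ ⟩
    count (R? x) ys + count (∁? (R? x)) ys + edges ys        ≡⟨ cong (_+ edges ys) (count+count-∁ (R? x) ys) ⟩
    length ys + edges ys                                     ∎
    where open ≡-Reasoning

  edges≤apexEdges : ∀ xs → edges xs ≤ apexEdges (length xs) 0
  edges≤apexEdges []       = z≤n
  edges≤apexEdges (x ∷ xs) =
    +-mono-≤ (subst (count (R? x) xs ≤_) (sym (+-identityʳ _)) (count≤length (R? x) xs)) (edges≤apexEdges xs)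

  record LowDegreeVertex (s : ℕ) (xs : List A) : Set where
    constructor lowDegreeVertex
    field
      vertex         : A
      others         : List A
      split          : xs ↭ vertex ∷ others
      nonNeighbours≥ : s ≤ count (∁? (R? vertex)) others

  edges-peel : ∀ {s xs} (v : LowDegreeVertex s xs) →
               edges xs + s ≤ length (LowDegreeVertex.others v) + edges (LowDegreeVertex.others v)
  edges-peel {s} {xs} (lowDegreeVertex x ys split s≤) = begin
    edges xs + s                        ≤⟨ +-monoʳ-≤ (edges xs) s≤ ⟩
    edges xs + count (∁? (R? x)) ys     ≡⟨ edges-removal split ⟩
    length ys + edges ys                ∎
    where open ≤-Reasoning

  CliqueFree : ℕ → List A → Set
  CliqueFree k xs = ∀ {cs rest} → xs ↭ cs ++ rest → AllPairs R cs → length cs < k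

  CliqueFree-remove : ∀ {k x xs ys} → CliqueFree k xs → xs ↭ x ∷ ys → CliqueFree k ys
  CliqueFree-remove {x = x} free xs↭ {cs} {rest} ys↭ =
    free (↭-trans xs↭ (↭-trans (prep x ys↭) (↭-sym (shift x cs rest))))

  Common : List A → Pred A 0ℓ
  Common cs z = All (λ c → R c z) cs

  common? : ∀ cs → Decidable (Common cs)
  common? cs z = All.all? (λ c → R? c z) cs

  private
    moveToFront : ∀ {xs cs rest rest′ : List A} {B} → xs ↭ cs ++ rest → rest ↭ B ∷ rest′ → xs ↭ B ∷ cs ++ rest′
    moveToFront {cs = cs} {rest′ = rest′} {B} split rest↭ = ↭-trans split (↭-trans (++⁺ˡ cs rest↭) (shift B cs rest′))

    common-shrink : ∀ {s cs rest B rest′} → rest ↭ B ∷ rest′ → Common cs B →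
                    count (∁? (R? B)) (cs ++ rest′) < s →
                    count (common? cs) rest ≤ count (common? (B ∷ cs)) rest′ + s
    common-shrink {s} {cs} {rest} {B} {rest′} rest↭ B-common few = begin
      count (common? cs) rest
        ≡⟨ trans (count-↭ (common? cs) rest↭) (count-accept (common? cs) B rest′ B-common) ⟩
      suc (count (common? cs) rest′)
        ≡⟨ cong suc (count-split (common? cs) (R? B) rest′) ⟩
      suc (count (common? cs ∩? R? B) rest′ + count (common? cs ∩? ∁? (R? B)) rest′)
        ≡⟨ sym (+-suc _ _) ⟩
      count (common? cs ∩? R? B) rest′ + suc (count (common? cs ∩? ∁? (R? B)) rest′)
        ≤⟨ +-mono-≤ (count-mono _ (common? (B ∷ cs)) (All.universal (λ _ (c , b) → b ∷ c) rest′))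
                    (≤-<-trans (count-mono _ (∁? (R? B)) (All.universal (λ _ → proj₂) rest′))
                               (≤-<-trans (m≤n+m _ (count (∁? (R? B)) cs))
                                          (subst (_< s) (count-++ (∁? (R? B)) cs rest′) few))) ⟩
      count (common? (B ∷ cs)) rest′ + s
        ∎
      where open ≤-Reasoning

  module _ {k s : ℕ} {xs : List A} (free : CliqueFree (suc k) xs) where

    -- Grow a clique inside its common neighbourhood: unless the added vertex has s non-neighbours,
    -- the common neighbourhood loses at most s vertices per step, so a (k+1)-clique would arise.
    private
      grow : ∀ r {cs rest} → xs ↭ cs ++ rest → AllPairs R cs → length cs + r ≡ k →
             r * s < count (common? cs) rest → LowDegreeVertex s xs
      next : ∀ r {cs rest} → xs ↭ cs ++ rest → AllPairs R cs → length cs + r ≡ suc k →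
             r * s < count (common? cs) rest + s → LowDegreeVertex s xs

      grow r {cs} split clique size many
        with B , B∈rest , B-common ← ∈-of-0<count (common? cs) (≤-<-trans z≤n many)
        with rest′ , rest↭ ← ∈⇒∃↭ B∈rest
        with s ≤? count (∁? (R? B)) (cs ++ rest′)
      ... | yes sparse = lowDegreeVertex B (cs ++ rest′) (moveToFront split rest↭) sparse
      ... | no ¬sparse = next r (moveToFront split rest↭) (All.map R-sym B-common ∷ clique) (cong suc size)
                              (<-≤-trans many (common-shrink rest↭ B-common (≰⇒> ¬sparse)))

      next zero    split clique size _    = ⊥-elim (<-irrefl (trans (sym (+-identityʳ _)) size) (free split clique))
      next (suc r) split clique size many =
        grow r split clique (suc-injective (trans (sym (+-suc _ r)) size)) (invariant-step 0 r s many ≤-refl)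

    cliqueFree⇒lowDegreeVertex : k * s < length xs → LowDegreeVertex s xs
    cliqueFree⇒lowDegreeVertex k*s<len =
      grow k ↭.refl [] refl (subst (k * s <_) (sym (count-all (common? []) (All.universal (λ _ → []) xs))) k*s<len)

  edges≤turan : ∀ {m} n {xs} → length xs ≡ n → CliqueFree (suc (suc m)) xs → edges xs ≤ turan n (suc m)
  edges≤turan         zero    {[]} _   _    = z≤n
  edges≤turan {m = m} (suc n) {xs} len free = +-cancelʳ-≤ s (edges xs) _ (begin
    edges xs + s                ≤⟨ edges-peel v ⟩
    length ys + edges ys        ≡⟨ cong (_+ edges ys) length-ys ⟩
    n + edges ys                ≤⟨ +-monoʳ-≤ n (edges≤turan n length-ys (CliqueFree-remove free split)) ⟩
    n + turan n (suc m)         ≡⟨ +-comm n _ ⟩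
    turan n (suc m) + n         ≡⟨ turan-suc-sameClass n ⟩
    turan (suc n) (suc m) + s   ∎)
    where
      open ≤-Reasoning
      open TuranNumbers m
      s = sameClassBelow n
      v : LowDegreeVertex s xs
      v = cliqueFree⇒lowDegreeVertex free (≤-<-trans (sameClassBelow-bound n) (subst (n <_) (sym len) ≤-refl))
      open LowDegreeVertex v renaming (others to ys)
      length-ys : length ys ≡ n
      length-ys = suc-injective (trans (sym (↭-length split)) len)

module _ {d : ℕ} where

  Intersect⇒lo≤hi : ∀ (A B : Box d) → Intersect A B → ∀ c → lo A c ℚ.≤ hi B c
  Intersect⇒lo≤hi _ _ (_ , p∈A , p∈B) c = ℚ.≤-trans (proj₁ (p∈A c)) (proj₂ (p∈B c))

  Intersect-sym : ∀ {A B : Box d} → Intersect A B → Intersect B A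
  Intersect-sym (p , p∈A , p∈B) = p , p∈B , p∈A

  LowsBelowHighs : List (Box d) → Set
  LowsBelowHighs Bs = ∀ {A X} → A ∈ Bs → X ∈ Bs → ∀ c → lo A c ℚ.≤ hi X c

  -- Helly for boxes: the coordinatewise maximum of the lower corners lies in every box.
  helly : ∀ Bs → LowsBelowHighs Bs → ∃ λ p → All (p ∈Box_) Bs
  helly []       _          = (λ _ → 0ℚ) , []
  helly (B ∷ Bs) lows≤highs = p , All.tabulate λ X∈ c → lo≤p X∈ c , p≤hi X∈ c
    where
      p : Point d
      p c = max (lo B c) (map (λ A → lo A c) Bs)

      lo≤p : ∀ {X} → X ∈ B ∷ Bs → ∀ c → lo X c ℚ.≤ p c
      lo≤p (here refl) c = ⊥≤max (lo B c) (map (λ A → lo A c) Bs)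
      lo≤p (there X∈)  c = All.lookup (xs≤max (lo B c) (map (λ A → lo A c) Bs)) (∈-map⁺ (λ A → lo A c) X∈)

      p≤hi : ∀ {X} → X ∈ B ∷ Bs → ∀ c → p c ℚ.≤ hi X c
      p≤hi X∈ c = max≤v⁺ (lows≤highs (here refl) X∈ c) (map⁺ (All.tabulate λ A∈ → lows≤highs (there A∈) X∈ c))

  pairwise⇒lowsBelowHighs : ∀ {Bs : List (Box d)} → AllPairs Intersect Bs → LowsBelowHighs Bs
  pairwise⇒lowsBelowHighs {B ∷ _} _        (here refl) (here refl) = lo≤hi B
  pairwise⇒lowsBelowHighs {B ∷ _} (B∩ ∷ _) {X = X} (here refl) (there X∈) =
    Intersect⇒lo≤hi B X (All.lookup B∩ X∈)
  pairwise⇒lowsBelowHighs {B ∷ _} (B∩ ∷ _) {A = A} (there A∈) (here refl) =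
    Intersect⇒lo≤hi A B (Intersect-sym {B} {A} (All.lookup B∩ A∈))
  pairwise⇒lowsBelowHighs (_ ∷ pairwise) (there A∈) (there X∈) = pairwise⇒lowsBelowHighs pairwise A∈ X∈

  _∈Box?_ : ∀ (p : Point d) → Decidable (p ∈Box_)
  p ∈Box? B = all? λ c → lo B c ℚ.≤? p c ×-dec p c ℚ.≤? hi B c

  lowsBelowHighs-pair : ∀ {A B} → (∀ c → lo A c ℚ.≤ hi B c) → (∀ c → lo B c ℚ.≤ hi A c) → LowsBelowHighs (A ∷ B ∷ [])
  lowsBelowHighs-pair {A} _   _   (here refl)         (here refl)         = lo≤hi A
  lowsBelowHighs-pair     A≤B _   (here refl)         (there (here refl)) = A≤B
  lowsBelowHighs-pair     _   B≤A (there (here refl)) (here refl)         = B≤A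
  lowsBelowHighs-pair {B = B} _ _ (there (here refl)) (there (here refl)) = lo≤hi B

  corners⇒Intersect : ∀ {A B} → (∀ c → lo A c ℚ.≤ hi B c) → (∀ c → lo B c ℚ.≤ hi A c) → Intersect A B
  corners⇒Intersect {A} {B} A≤B B≤A with p , p∈A ∷ p∈B ∷ [] ← helly (A ∷ B ∷ []) (lowsBelowHighs-pair A≤B B≤A) =
    p , p∈A , p∈B

  intersect? : ∀ A → Decidable (Intersect A)
  intersect? A B = map′ (λ (A≤B , B≤A) → corners⇒Intersect {A} {B} A≤B B≤A)
                        (λ A∩B → Intersect⇒lo≤hi A B A∩B , Intersect⇒lo≤hi B A (Intersect-sym {A} {B} A∩B))
                        (all? (λ c → lo A c ℚ.≤? hi B c) ×-dec all? (λ c → lo B c ℚ.≤? hi A c))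

  open Graph intersect? (λ {A} {B} → Intersect-sym {A} {B}) public

  DepthAtMost : ℕ → List (Box d) → Set
  DepthAtMost k Bs = ∀ (p : Point d) → count (p ∈Box?_) Bs ≤ k

  DepthAtMost-remove : ∀ {k B Bs Cs} → DepthAtMost k Bs → Bs ↭ B ∷ Cs → DepthAtMost k Cs
  DepthAtMost-remove {B = B} {Cs = Cs} depth Bs↭ p =
    ≤-trans (count≤count-∷ (p ∈Box?_) B Cs) (≤-trans (≤-reflexive (sym (count-↭ (p ∈Box?_) Bs↭))) (depth p))

  depth⇒cliqueFree : ∀ {k Bs} → DepthAtMost k Bs → CliqueFree (suc k) Bs
  depth⇒cliqueFree {k} {Bs} depth {cs} {rest} split clique = s≤s (begin
    length cs                                       ≡⟨ sym (count-all (p ∈Box?_) p∈cs) ⟩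
    count (p ∈Box?_) cs                             ≤⟨ m≤m+n (count (p ∈Box?_) cs) (count (p ∈Box?_) rest) ⟩
    count (p ∈Box?_) cs + count (p ∈Box?_) rest     ≡⟨ sym (count-++ (p ∈Box?_) cs rest) ⟩
    count (p ∈Box?_) (cs ++ rest)                   ≡⟨ sym (count-↭ (p ∈Box?_) split) ⟩
    count (p ∈Box?_) Bs                             ≤⟨ depth p ⟩
    k                                               ∎)
    where
      open ≤-Reasoning
      p : Point d
      p = proj₁ (helly cs (pairwise⇒lowsBelowHighs clique))
      p∈cs : All (p ∈Box_) cs
      p∈cs = proj₂ (helly cs (pairwise⇒lowsBelowHighs clique))

  module _ {k y : ℕ} {Bs : List (Box d)} (depth : DepthAtMost k Bs) where

    private
      ContainsExcept : List (Fin d) → Point d → Pred (Box d) 0ℓ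
      ContainsExcept todo r C = ∀ c → c ∉ todo → lo C c ℚ.≤ r c × r c ℚ.≤ hi C c

      containsExcept? : ∀ todo r → Decidable (ContainsExcept todo r)
      containsExcept? todo r C = all? λ c → ¬? (Any.any? (c ≟ᶠ_) todo) →-dec (lo C c ℚ.≤? r c ×-dec r c ℚ.≤? hi C c)

      shrink : ∀ c todo r {B others} → Bs ↭ B ∷ others →
               (∀ {C} → C ∈ Bs → ContainsExcept (c ∷ todo) r C → hi B c ℚ.≤ hi C c) →
               count (∁? (intersect? B)) others ≤ y →
               count (containsExcept? (c ∷ todo) r) Bs ≤ count (containsExcept? todo (updateAt r c λ _ → hi B c)) Bs + y
      shrink c todo r {B} {others} split B-lowest few = begin
        count P? Bs                                           ≡⟨ count-split P? meets? Bs ⟩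
        count (P? ∩? meets?) Bs + count (P? ∩? ∁? meets?) Bs  ≤⟨ +-mono-≤ stay leave ⟩
        count P′? Bs + y                                      ∎
        where
          open ≤-Reasoning
          r′ : Point d
          r′ = updateAt r c λ _ → hi B c
          P? = containsExcept? (c ∷ todo) r
          P′? = containsExcept? todo r′
          Meets : Pred (Box d) 0ℓ
          Meets C = lo C c ℚ.≤ hi B c
          meets? : Decidable Meets
          meets? C = lo C c ℚ.≤? hi B c

          contains′ : ∀ {C} → C ∈ Bs → ContainsExcept (c ∷ todo) r C × Meets C → ContainsExcept todo r′ C
          contains′ {C} C∈ (contains , meets) c′ c′∉todo with c′ ≟ᶠ c
          ... | yes refl = subst (λ v → lo C c ℚ.≤ v × v ℚ.≤ hi C c) (sym (updateAt-updates c r)) (meets , B-lowest C∈ contains)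
          ... | no c′≢c  = subst (λ v → lo C c′ ℚ.≤ v × v ℚ.≤ hi C c′) (sym (updateAt-minimal c′ c r c′≢c))
                                 (contains c′ λ { (here c′≡c) → c′≢c c′≡c ; (there c′∈) → c′∉todo c′∈ })

          stay : count (P? ∩? meets?) Bs ≤ count P′? Bs
          stay = count-mono (P? ∩? meets?) P′? (All.tabulate contains′)

          leave : count (P? ∩? ∁? meets?) Bs ≤ y
          leave = begin
            count (P? ∩? ∁? meets?) Bs            ≡⟨ count-↭ (P? ∩? ∁? meets?) split ⟩
            count (P? ∩? ∁? meets?) (B ∷ others)  ≡⟨ count-reject (P? ∩? ∁? meets?) B others (λ (_ , ¬meets) → ¬meets (lo≤hi B c)) ⟩
            count (P? ∩? ∁? meets?) others        ≤⟨ count-mono (P? ∩? ∁? meets?) (∁? (intersect? B)) (All.universal disjoint others) ⟩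
            count (∁? (intersect? B)) others      ≤⟨ few ⟩
            y                                     ∎
            where
              disjoint : ∀ C → ContainsExcept (c ∷ todo) r C × ¬ Meets C → ¬ Intersect B C
              disjoint C (_ , ¬meets) B∩C = ¬meets (Intersect⇒lo≤hi C B (Intersect-sym {B} {C} B∩C) c)

      -- In coordinate c, the candidate B with the lowest upper end is disjoint from every candidate
      -- starting above hi B c, and every other candidate contains hi B c in that coordinate.
      peel : ∀ todo r → k + length todo * y < count (containsExcept? todo r) Bs → LowDegreeVertex (suc y) Bs
      peel [] r many = contradiction
        (≤-trans (count-mono (containsExcept? [] r) (r ∈Box?_) (All.universal (λ C contains c → contains c λ ()) Bs)) (depth r))
        (<⇒≱ (≤-<-trans (m≤m+n k 0) many))
      peel (c ∷ todo) r many
        with B , B∈Bs , _ , B-lowest ← argmin-on (λ C → hi C c) (containsExcept? (c ∷ todo) r) (≤-<-trans z≤n many)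
        with others , split ← ∈⇒∃↭ B∈Bs
        with suc y ≤? count (∁? (intersect? B)) others
      ... | yes sparse = lowDegreeVertex B others split sparse
      ... | no ¬sparse = peel todo (updateAt r c λ _ → hi B c)
                              (invariant-step k (length todo) y many (shrink c todo r split B-lowest (≤-pred (≰⇒> ¬sparse))))

    disjointFromMany : k + d * y < length Bs → LowDegreeVertex (suc y) Bs
    disjointFromMany k+dy<len = peel (allFin d) (λ _ → 0ℚ)
      (subst₂ (λ n c → k + n * y < c) (sym (length-tabulate {n = d} id)) (sym (count-all (containsExcept? (allFin d) _) containsAll)) k+dy<len)
      where
        containsAll : All (ContainsExcept (allFin d) (λ _ → 0ℚ)) Bs
        containsAll = All.universal (λ C c c∉ → contradiction (∈-allFin c) c∉) Bs

edges≤turan+apexEdges : ∀ {m} u N {Bs : List (Box (suc m))} → length Bs ≡ u + N → DepthAtMost (suc m + u) Bs →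
                        edges Bs ≤ turan N (suc m) + apexEdges u N
edges≤turan+apexEdges u zero    {Bs}   len _ = subst (λ n → edges Bs ≤ apexEdges n 0) (trans len (+-identityʳ u)) (edges≤apexEdges Bs)
edges≤turan+apexEdges u (suc N) {[]}   len _ = contradiction (trans len (+-suc u N)) λ ()
edges≤turan+apexEdges {m} u (suc N) {Bs@(B₀ ∷ _)} len depth = +-cancelʳ-≤ s (edges Bs) _ (begin
  edges Bs + s                                  ≤⟨ edges-peel v ⟩
  length others + edges others                  ≡⟨ cong (_+ edges others) length-others ⟩
  (u + N) + edges others                        ≤⟨ +-monoʳ-≤ (u + N) (edges≤turan+apexEdges u N {others} length-others (DepthAtMost-remove depth split)) ⟩
  (u + N) + (turan N M + apexEdges u N)         ≡⟨ solve 4 (λ u N t a → (u :+ N) :+ (t :+ a) := (t :+ N) :+ (a :+ u)) refl u N (turan N M) (apexEdges u N) ⟩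
  (turan N M + N) + (apexEdges u N + u)         ≡⟨ cong₂ _+_ (turan-suc-sameClass N) (sym (apexEdges-suc u N)) ⟩
  (turan (suc N) M + s) + apexEdges u (suc N)   ≡⟨ xy∙z≈xz∙y (turan (suc N) M) s _ ⟩
  turan (suc N) M + apexEdges u (suc N) + s     ∎)
  where
    open ≤-Reasoning
    open TuranNumbers m
    M = suc m
    s = sameClassBelow N

    lowDegree : ∀ s → M * s ≤ N → LowDegreeVertex s Bs
    lowDegree zero    _          = lowDegreeVertex B₀ _ ↭.refl z≤n
    lowDegree (suc y) M[1+y]≤N = disjointFromMany depth (begin-strict
      (M + u) + M * y   ≡⟨ xy∙z≈y∙xz M u (M * y) ⟩
      u + (M + M * y)   ≡⟨ cong (u +_) (sym (*-suc M y)) ⟩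
      u + M * suc y     ≤⟨ +-monoʳ-≤ u M[1+y]≤N ⟩
      u + N             <⟨ n<1+n (u + N) ⟩
      suc (u + N)       ≡⟨ sym (trans len (+-suc u N)) ⟩
      length Bs         ∎)

    v : LowDegreeVertex s Bs
    v = lowDegree s (sameClassBelow-bound N)
    open LowDegreeVertex v

    length-others : length others ≡ u + N
    length-others = suc-injective (trans (sym (↭-length split)) (trans len (+-suc u N)))

module _ {A : Set} {P : Pred A 0ℓ} (P? : Decidable P) where

  subset⇒count : ∀ {n} (f : Fin n → A) (S : Subset n) → (∀ i → i Subset.∈ S → P (f i)) → ∣ S ∣ ≤ count P? (tabulate f)
  subset⇒count {zero}  f []            _   = z≤n
  subset⇒count {suc n} f (outside ∷ S) inS =
    ≤-trans (subset⇒count (f ∘ suc) S (λ i i∈ → inS (suc i) (there i∈))) (count≤count-∷ P? (f zero) _)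
  subset⇒count {suc n} f (inside ∷ S)  inS =
    subst (suc ∣ S ∣ ≤_) (sym (count-accept P? (f zero) _ (inS zero here)))
          (s≤s (subset⇒count (f ∘ suc) S (λ i i∈ → inS (suc i) (there i∈))))

  count⇒subset : ∀ {n} (f : Fin n → A) m → m ≤ count P? (tabulate f) →
                 Σ[ S ∈ Subset n ] ∣ S ∣ ≡ m × (∀ i → i Subset.∈ S → P (f i))
  count⇒subset {n}     f zero    _   = Subset.⊥ , ∣⊥∣≡0 n , λ _ i∈⊥ → contradiction i∈⊥ ∉⊥
  count⇒subset {suc n} f (suc m) m<c with P? (f zero)
  ... | yes Pf₀ with S , ∣S∣≡m , inS ← count⇒subset (f ∘ suc) m (≤-pred m<c) =
    inside ∷ S , cong suc ∣S∣≡m , λ { zero here → Pf₀ ; (suc i) (there i∈) → inS i i∈ }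
  ... | no _ with S , ∣S∣≡m , inS ← count⇒subset (f ∘ suc) (suc m) m<c =
    outside ∷ S , ∣S∣≡m , λ { (suc i) (there i∈) → inS i i∈ }

orderedPairs : ∀ n → List (Fin n × Fin n)
orderedPairs zero    = []
orderedPairs (suc n) = map (λ j → zero , suc j) (allFin n) ++ map (Product.map suc suc) (orderedPairs n)

∈-orderedPairs⁺ : ∀ {n} {i j : Fin n} → i Fin.< j → (i , j) ∈ orderedPairs n
∈-orderedPairs⁺ {suc n} {zero}  {suc j} _         = ∈-++⁺ˡ (∈-map⁺ _ (∈-allFin j))
∈-orderedPairs⁺ {suc n} {suc i} {suc j} (s≤s i<j) = ∈-++⁺ʳ _ (∈-map⁺ _ (∈-orderedPairs⁺ i<j))

∈-orderedPairs⁻ : ∀ {n} {i j : Fin n} → (i , j) ∈ orderedPairs n → i Fin.< j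
∈-orderedPairs⁻ {suc n} ij∈ with ∈-++⁻ (map (λ j → zero , suc j) (allFin n)) ij∈
... | inj₁ ij∈first with _ , _ , refl ← ∈-map⁻ _ ij∈first = s≤s z≤n
... | inj₂ ij∈rest  with _ , ij′∈ , refl ← ∈-map⁻ _ ij∈rest = s≤s (∈-orderedPairs⁻ ij′∈)

orderedPairs-unique : ∀ n → Unique (orderedPairs n)
orderedPairs-unique zero    = []
orderedPairs-unique (suc n) = unique-++⁺
  (unique-map⁺ (suc-injectiveᶠ ∘ cong proj₂) (allFin⁺ n))
  (unique-map⁺ (λ eq → cong₂ _,_ (suc-injectiveᶠ (cong proj₁ eq)) (suc-injectiveᶠ (cong proj₂ eq))) (orderedPairs-unique n))
  disjoint
  where
    disjoint : ∀ {ij} → ¬ (ij ∈ map (λ j → zero , suc j) (allFin n) × ij ∈ map (Product.map suc suc) (orderedPairs n))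
    disjoint (ij∈first , ij∈rest) with _ , _ , refl ← ∈-map⁻ _ ij∈first with _ , _ , () ← ∈-map⁻ _ ij∈rest

intersecting? : ∀ {n d} (F : Family n d) → Decidable (λ (ij : Fin n × Fin n) → Intersect (F (proj₁ ij)) (F (proj₂ ij)))
intersecting? F ij = intersect? (F (proj₁ ij)) (F (proj₂ ij))

intersectingPairs : ∀ {n d} → Family n d → List (Fin n × Fin n)
intersectingPairs {n} F = filter (intersecting? F) (orderedPairs n)

length-intersectingPairs : ∀ {n d} (F : Family n d) → length (intersectingPairs F) ≡ edges (tabulate F)
length-intersectingPairs {zero}  F = refl
length-intersectingPairs {suc n} F = begin
  count (intersecting? F) (firsts ++ rest)                          ≡⟨ count-++ (intersecting? F) firsts rest ⟩
  count (intersecting? F) firsts + count (intersecting? F) rest     ≡⟨ cong₂ _+_ count-firsts count-rest ⟩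
  count (intersect? (F zero)) (tabulate (F ∘ suc)) + edges (tabulate (F ∘ suc)) ∎
  where
    open ≡-Reasoning
    firsts rest : List (Fin (suc n) × Fin (suc n))
    firsts = map (λ j → zero , suc j) (allFin n)
    rest   = map (Product.map suc suc) (orderedPairs n)

    count-firsts : count (intersecting? F) firsts ≡ count (intersect? (F zero)) (tabulate (F ∘ suc))
    count-firsts = begin
      count (intersecting? F) firsts                          ≡⟨ count-map (intersecting? F) _ (allFin n) ⟩
      count (λ j → intersect? (F zero) (F (suc j))) (allFin n) ≡⟨ sym (count-map (intersect? (F zero)) (F ∘ suc) (allFin n)) ⟩
      count (intersect? (F zero)) (map (F ∘ suc) (allFin n))  ≡⟨ cong (count (intersect? (F zero))) (map-tabulate id (F ∘ suc)) ⟩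
      count (intersect? (F zero)) (tabulate (F ∘ suc))        ∎

    count-rest : count (intersecting? F) rest ≡ edges (tabulate (F ∘ suc))
    count-rest = trans (count-map (intersecting? F) _ (orderedPairs n)) (length-intersectingPairs (F ∘ suc))

numIntersectingPairs-edges : ∀ {n d} (F : Family n d) → NumIntersectingPairs F (edges (tabulate F))
numIntersectingPairs-edges {n} F =
  intersectingPairs F ,
  unique-filter⁺ (intersecting? F) (orderedPairs-unique n) ,
  All.tabulate (λ ij∈ → Product.map₁ ∈-orderedPairs⁻ (∈-filter⁻ (intersecting? F) ij∈)) ,
  (λ i j i<j i∩j → ∈-filter⁺ (intersecting? F) (∈-orderedPairs⁺ i<j) i∩j) ,
  length-intersectingPairs F

numIntersectingPairs≤edges : ∀ {n d} (F : Family n d) {c} → NumIntersectingPairs F c → c ≤ edges (tabulate F)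
numIntersectingPairs≤edges F (L , unique , sound , _ , refl) =
  subst (length L ≤_) (length-intersectingPairs F) (unique-⊆⇒length≤ unique λ ij∈L →
    let i<j , i∩j = All.lookup sound ij∈L in ∈-filter⁺ (intersecting? F) (∈-orderedPairs⁺ i<j) i∩j)

module _ {n d k : ℕ} (F : Family n d) where

  depth⇒noKPlus1Common : DepthAtMost k (tabulate F) → NoKPlus1Common k F
  depth⇒noKPlus1Common depth S ∣S∣≡1+k (p , p∈S) =
    <-irrefl refl (≤-trans (subst (_≤ _) ∣S∣≡1+k (subset⇒count (p ∈Box?_) F S p∈S)) (depth p))

  noKPlus1Common⇒depth : NoKPlus1Common k F → DepthAtMost k (tabulate F)
  noKPlus1Common⇒depth noCommon p with count (p ∈Box?_) (tabulate F) ≤? k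
  ... | yes depth≤k = depth≤k
  ... | no depth≰k with S , ∣S∣≡1+k , p∈S ← count⇒subset (p ∈Box?_) F (suc k) (≰⇒> depth≰k) =
    contradiction (p , p∈S) (noCommon S ∣S∣≡1+k)

isT-intro : ∀ {n k d v} (F : Family n d) → DepthAtMost k (tabulate F) → edges (tabulate F) ≡ v →
            (∀ {Bs : List (Box d)} → length Bs ≡ n → DepthAtMost k Bs → edges Bs ≤ v) → IsT n k d v
isT-intro F depth edges≡v bound =
  (F , depth⇒noKPlus1Common F depth , subst (NumIntersectingPairs F) edges≡v (numIntersectingPairs-edges F)) ,
  λ G c noCommon pairs → ≤-trans (numIntersectingPairs≤edges G pairs) (bound {tabulate G} (length-tabulate G) (noKPlus1Common⇒depth G noCommon))

fromℕ : ℕ → ℚ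
fromℕ i = ℚ.mkℚ (ℤ.+ i) 0 (Coprime.sym (1-coprimeTo i))

fromℕ-mono-≤ : ∀ {i j} → i ≤ j → fromℕ i ℚ.≤ fromℕ j
fromℕ-mono-≤ {i} {j} i≤j = ℚ.*≤* (subst₂ ℤ._≤_ (sym (ℤ.*-identityʳ (ℤ.+ i))) (sym (ℤ.*-identityʳ (ℤ.+ j))) (+≤+ i≤j))

fromℕ-injective : ∀ {i j} → fromℕ i ≡ fromℕ j → i ≡ j
fromℕ-injective = ℤ.+-injective ∘ cong ℚ.numerator

-- Box i < N is the slab pinning coordinate i mod M to the value i, box i ≥ N is the cube [0, N]^D.
module Construction {D : ℕ} (m N : ℕ) (M≤D : suc m ≤ D) where

  private
    M = suc m

  open TuranNumbers m

  axis : ℕ → Fin D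
  axis i = fromℕ< (<-≤-trans (m%n<n i M) M≤D)

  axis-cong : ∀ {i j} → i % M ≡ j % M → axis i ≡ axis j
  axis-cong {i} {j} eq = fromℕ<-cong (i % M) (j % M) eq _ _

  axis-injective : ∀ {i j} → axis i ≡ axis j → i % M ≡ j % M
  axis-injective {i} {j} = fromℕ<-injective (i % M) (j % M) _ _

  Pinned : ℕ → Fin D → Set
  Pinned i c = i < N × axis i ≡ c

  pinned? : ∀ i c → Dec (Pinned i c)
  pinned? i c = i <? N ×-dec axis i ≟ᶠ c

  lower upper : ℕ → Fin D → ℚ
  lower i c with pinned? i c
  ... | yes _ = fromℕ i
  ... | no _  = fromℕ 0
  upper i c with pinned? i c
  ... | yes _ = fromℕ i
  ... | no _  = fromℕ N

  lower≤upper : ∀ i c → lower i c ℚ.≤ upper i c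
  lower≤upper i c with pinned? i c
  ... | yes _ = ℚ.≤-refl
  ... | no _  = fromℕ-mono-≤ z≤n

  box : ℕ → Box D
  box i = record { lo = lower i ; hi = upper i ; lo≤hi = lower≤upper i }

  ∈box⇒pinnedValue : ∀ {p i} → p ∈Box box i → i < N → p (axis i) ≡ fromℕ i
  ∈box⇒pinnedValue {p} {i} p∈ i<N with pinned? i (axis i) | p∈ (axis i)
  ... | yes _        | i≤p , p≤i = ℚ.≤-antisym p≤i i≤p
  ... | no ¬pinned   | _         = contradiction (i<N , refl) ¬pinned

  lower≤upper-unless-copinned : ∀ i j c → ¬ (Pinned i c × Pinned j c) → lower i c ℚ.≤ upper j c
  lower≤upper-unless-copinned i j c ¬both with pinned? i c | pinned? j c
  ... | yes pi      | yes pj = contradiction (pi , pj) ¬both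
  ... | yes (i<N , _) | no _ = fromℕ-mono-≤ (<⇒≤ i<N)
  ... | no _        | yes _  = fromℕ-mono-≤ z≤n
  ... | no _        | no _   = fromℕ-mono-≤ z≤n

  box-intersect : ∀ {i j} → (i < N → j < N → i % M ≢ j % M) → Intersect (box i) (box j)
  box-intersect {i} {j} differ = corners⇒Intersect {A = box i} {B = box j}
    (λ c → lower≤upper-unless-copinned i j c notBoth)
    (λ c → lower≤upper-unless-copinned j i c (notBoth ∘ Product.swap))
    where
      notBoth : ∀ {c} → ¬ (Pinned i c × Pinned j c)
      notBoth ((i<N , i↦c) , (j<N , j↦c)) = differ i<N j<N (axis-injective {i} {j} (trans i↦c (sym j↦c)))

  box-disjoint : ∀ {i j} → i < N → j < N → i % M ≡ j % M → Intersect (box i) (box j) → i ≡ j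
  box-disjoint {i} {j} i<N j<N same (p , p∈i , p∈j) = fromℕ-injective (begin
    fromℕ i        ≡⟨ sym (∈box⇒pinnedValue {p} {i} p∈i i<N) ⟩
    p (axis i)     ≡⟨ cong p (axis-cong {i} {j} same) ⟩
    p (axis j)     ≡⟨ ∈box⇒pinnedValue {p} {j} p∈j j<N ⟩
    fromℕ j        ∎)
    where open ≡-Reasoning

  edges-pinned : ∀ j → j ≤ N → edges (map box (downFrom j)) ≡ turan j M
  edges-pinned zero    _   = refl
  edges-pinned (suc j) j<N = begin
    count (intersect? (box j)) (map box (downFrom j)) + edges (map box (downFrom j))
      ≡⟨ cong₂ _+_ neighbours (edges-pinned j (<⇒≤ j<N)) ⟩
    differentClassBelow j + turan j M   ≡⟨ +-comm (differentClassBelow j) _ ⟩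
    turan j M + differentClassBelow j   ≡⟨ sym (turan-suc j) ⟩
    turan (suc j) M                     ∎
    where
      open ≡-Reasoning
      i<N : ∀ {i} → i ∈ downFrom j → i < N
      i<N i∈ = <-trans (∈-downFrom⁻ i∈) j<N

      meet⇒differ : ∀ {i} → i ∈ downFrom j → Intersect (box j) (box i) → ¬ SameClass j i
      meet⇒differ i∈ j∩i same = <-irrefl (sym (box-disjoint j<N (i<N i∈) (sym same) j∩i)) (∈-downFrom⁻ i∈)

      differ⇒meet : ∀ {i} → i ∈ downFrom j → ¬ SameClass j i → Intersect (box j) (box i)
      differ⇒meet _ differ = box-intersect λ _ _ same → differ (sym same)

      neighbours : count (intersect? (box j)) (map box (downFrom j)) ≡ differentClassBelow j
      neighbours = trans (count-map (intersect? (box j)) box (downFrom j))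
        (≤-antisym (count-mono (intersect? (box j) ∘ box) (∁? (sameClass? j)) (All.tabulate meet⇒differ))
                   (count-mono (∁? (sameClass? j)) (intersect? (box j) ∘ box) (All.tabulate differ⇒meet)))

  edges-apex : ∀ t → edges (map box (downFrom (t + N))) ≡ turan N M + apexEdges t N
  edges-apex zero    = trans (edges-pinned N ≤-refl) (sym (+-identityʳ _))
  edges-apex (suc t) = begin
    count (intersect? (box (t + N))) (map box (downFrom (t + N))) + edges (map box (downFrom (t + N)))
      ≡⟨ cong₂ _+_ neighbours (edges-apex t) ⟩
    (t + N) + (turan N M + apexEdges t N)   ≡⟨ x∙yz≈y∙xz (t + N) (turan N M) _ ⟩
    turan N M + ((t + N) + apexEdges t N)   ∎
    where
      open ≡-Reasoning
      neighbours : count (intersect? (box (t + N))) (map box (downFrom (t + N))) ≡ t + N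
      neighbours = begin
        count (intersect? (box (t + N))) (map box (downFrom (t + N)))   ≡⟨ count-map (intersect? (box (t + N))) box (downFrom (t + N)) ⟩
        count (intersect? (box (t + N)) ∘ box) (downFrom (t + N))       ≡⟨ count-all (intersect? (box (t + N)) ∘ box) (All.universal apex-meets (downFrom (t + N))) ⟩
        length (downFrom (t + N))                                       ≡⟨ length-downFrom (t + N) ⟩
        t + N                                                           ∎
        where
          apex-meets : ∀ i → Intersect (box (t + N)) (box i)
          apex-meets i = box-intersect {t + N} {i} λ t+N<N → contradiction t+N<N (m+n≮n t N)

  -- the boxes containing p are determined by their class: box i pins coordinate axis i to the value i
  depth-pinned : DepthAtMost M (map box (downFrom N))
  depth-pinned p = begin
    count (p ∈Box?_) (map box (downFrom N))   ≡⟨ count-map (p ∈Box?_) box (downFrom N) ⟩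
    length containing                         ≤⟨ unique-⊆⇒length≤ (unique-filter⁺ _ {downFrom N} (downFrom⁺ N)) containing⊆ ⟩
    length (map value (upTo M))               ≡⟨ trans (length-map value (upTo M)) (length-upTo M) ⟩
    M                                         ∎
    where
      open ≤-Reasoning
      containing : List ℕ
      containing = filter ((p ∈Box?_) ∘ box) (downFrom N)

      value : ℕ → ℕ
      value r = ℤ.∣ ℚ.numerator (p (axis r)) ∣

      containing⊆ : ∀ {i} → i ∈ containing → i ∈ map value (upTo M)
      containing⊆ {i} i∈ = subst (_∈ map value (upTo M)) value≡i (∈-map⁺ value (∈-upTo⁺ (m%n<n i M)))
        where
          i<N : i < N
          i<N = ∈-downFrom⁻ (proj₁ (∈-filter⁻ ((p ∈Box?_) ∘ box) {xs = downFrom N} i∈))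
          value≡i : value (i % M) ≡ i
          value≡i = cong (ℤ.∣_∣ ∘ ℚ.numerator) (trans (cong p (axis-cong {i % M} {i} (m%n%n≡m%n i M)))
                      (∈box⇒pinnedValue {p} {i} (proj₂ (∈-filter⁻ ((p ∈Box?_) ∘ box) {xs = downFrom N} i∈)) i<N))

  depth-apex : ∀ t → DepthAtMost (M + t) (map box (downFrom (t + N)))
  depth-apex zero    p = subst (count (p ∈Box?_) (map box (downFrom N)) ≤_) (sym (+-identityʳ M)) (depth-pinned p)
  depth-apex (suc t) p = begin
    count (p ∈Box?_) (box (t + N) ∷ map box (downFrom (t + N)))   ≤⟨ count-∷-≤ (p ∈Box?_) (box (t + N)) _ ⟩
    suc (count (p ∈Box?_) (map box (downFrom (t + N))))           ≤⟨ s≤s (depth-apex t p) ⟩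
    suc (M + t)                                                   ≡⟨ sym (+-suc M t) ⟩
    M + suc t                                                     ∎
    where open ≤-Reasoning

  isT-construction : ∀ t {k v} → M + t ≡ k → turan N M + apexEdges t N ≡ v →
                     (∀ {Bs : List (Box D)} → length Bs ≡ t + N → DepthAtMost (M + t) Bs → edges Bs ≤ turan N M + apexEdges t N) →
                     IsT (t + N) k D v
  isT-construction t refl refl bound =
    isT-intro F (subst (DepthAtMost (M + t)) (sym F≡) (depth-apex t)) (trans (cong edges F≡) (edges-apex t)) (λ {Bs} → bound {Bs})
    where
      F : Family (t + N) D
      F i = box (t + N ∸ suc (Fin.toℕ i))
      F≡ : tabulate F ≡ map box (downFrom (t + N))
      F≡ = tabulate-downFrom box (t + N)

isT-d≤k : ∀ n k m → suc m ≤ k → k ≤ n →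
          ∃ λ b → IsT n (k ∸ suc m + 1) 1 b × IsT n k (suc m) (turan (n ∸ k + suc m) (suc m) + b)
isT-d≤k n k m d≤k k≤n =
  apexEdges u N ,
  subst (λ n → IsT n (u + 1) 1 (apexEdges u N)) u+N≡n
    (Construction.isT-construction 0 N ≤-refl u (+-comm 1 u) (cong (_+ apexEdges u N) (turan-1 N)) λ {Bs} → edges≤turan+apexEdges u N {Bs}) ,
  subst (λ n → IsT n k d (turan N d + apexEdges u N)) u+N≡n
    (Construction.isT-construction m N ≤-refl u (m+[n∸m]≡n d≤k) refl λ {Bs} → edges≤turan+apexEdges u N {Bs})
  where
    d u N : ℕ
    d = suc m
    u = k ∸ d
    N = n ∸ k + d
    u+N≡n : u + N ≡ n
    u+N≡n = begin
      u + (n ∸ k + d)   ≡⟨ x∙yz≈y∙zx u (n ∸ k) d ⟩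
      n ∸ k + (d + u)   ≡⟨ cong (n ∸ k +_) (m+[n∸m]≡n d≤k) ⟩
      n ∸ k + k         ≡⟨ m∸n+n≡m k≤n ⟩
      n                 ∎
      where open ≡-Reasoning

isT-k≤d : ∀ n k d → suc k ≤ d → IsT n (suc k) d (turan n (suc k))
isT-k≤d n k d k≤d = Construction.isT-construction k n k≤d 0 (+-identityʳ (suc k)) (+-identityʳ _) λ {Bs} len depth →
  ≤-trans (edges≤turan n {Bs} len (depth⇒cliqueFree (subst (λ k → DepthAtMost k Bs) (+-identityʳ (suc k)) depth))) (m≤m+n _ 0)

mainTheorem1 :
    (∀ (n k d : ℕ) → 1 ≤ d → d < k → k ≤ n →
      ∃ λ b → IsT n (k ∸ d + 1) 1 b × IsT n k d (turan (n ∸ k + d) d + b))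
    × (∀ (n k d : ℕ) → 1 ≤ k → k ≤ n → 1 ≤ d → k ≤ d → IsT n k d (turan n k))
mainTheorem1 =
  (λ { _ _ zero    () _ _ ; n k (suc m) _ d<k k≤n → isT-d≤k n k m (<⇒≤ d<k) k≤n }) ,
  (λ { _ zero    _ () _ _ _ ; n (suc k) d _ _ _ k≤d → isT-k≤d n k d k≤d })
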